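{- Let $q$ be a prime power and $n$ a positive integer. Let $\alpha\in \mathbb{F}_q$ and $R\subseteq \mathbb{F}_q\setminus \{\alpha\}$. Suppose a set $A\subseteq \mathbb{F}_q^n$ satisfies $\langle a,a\rangle =\alpha$ for every $a\in A$ and $\langle x,y\rangle\in R$ for any two distinct $x,y\in A$. Then $|A|\leq 2\binom{n+|R|}{|R|}$.
   Context: $\langle u,v\rangle=\sum_{i=1}^n u_iv_i$ denotes the standard dot product on $\mathbb{F}_q^n$. -}

module Defs where

open import Level using (Level; suc; _⊔_)
open import Data.Nat using (ℕ)
open import Data.Fin using (Fin)
open import Data.Vec using (Vec; foldr; zipWith)
open import Function.Bundles using (_↔_)
open import Relation.Binary.PropositionalEquality using (_≡_; _≢_)
open import Algebra.Structures using (IsCommutativeRing)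

-- A finite field: a commutative ring (with propositional equality) in which
-- 0 ≠ 1 and every nonzero element has a multiplicative inverse, whose carrier
-- is in bijection with Fin q for some q (q = order of the field, necessarily
-- a prime power).
record FiniteField (c : Level) : Set (suc c) where
  infixl 7 _*_
  infixl 6 _+_
  field
    Carrier : Set c
    _+_     : Carrier → Carrier → Carrier
    _*_     : Carrier → Carrier → Carrier
    -_      : Carrier → Carrier
    0#      : Carrier
    1#      : Carrier
    isCommutativeRing : IsCommutativeRing _≡_ _+_ _*_ -_ 0# 1#
    0≢1     : 0# ≢ 1#
    _⁻¹     : Carrier → Carrier
    ⁻¹-inverse : ∀ x → x ≢ 0# → x * (x ⁻¹) ≡ 1#
    q       : ℕ
    enum    : Carrier ↔ Fin q

module _ {c} (F : FiniteField c) where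
  open FiniteField F

  dot : ∀ {n} → Vec Carrier n → Vec Carrier n → Carrier
  dot u v = foldr _ _+_ 0# (zipWith _*_ u v)

-- For a ∈ A let f_a(x) = ∏_{r ∈ R} (⟨x, a⟩ - r), a polynomial of degree ≤ |R| in n
-- variables.  Then f_a(b) = 0 for distinct a, b ∈ A, while f_a(a) = ∏_{r ∈ R} (α - r) ≠ 0.
-- Writing f_a(b) as the dot product of the coefficient vector of f_a with the vector of
-- monomials evaluated at b, the two families form a biorthogonal system in a space of
-- dimension C(n + |R|, |R|), and Gaussian elimination shows that such a system has at
-- most that many members.  This is half the stated bound.
module Submission where

open import Defs
open import Data.Nat as ℕ using (ℕ; zero; suc; _≤_; z≤n; s≤s)
import Data.Nat.Properties as ℕₚ
open import Data.Nat.Combinatorics using (_C_; nCn≡1; nCk+nC[k+1]≡[n+1]C[k+1])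
open import Data.Fin as Fin using (Fin; punchIn)
import Data.Fin.Properties as Finₚ
open import Data.Vec as Vec using (Vec; []; _∷_; _++_; head; tail)
open import Data.List as List using (List; length)
open import Data.List.Membership.Propositional using (_∈_)
open import Data.List.Membership.Propositional.Properties using (∈-lookup)
open import Data.List.Relation.Unary.Any using (here; there)
import Data.List.Relation.Unary.All as All
open import Data.List.Relation.Unary.AllPairs using (_∷_)
open import Data.List.Relation.Unary.Unique.Propositional using (Unique)
open import Data.Product using (_,_)
open import Data.Empty using (⊥-elim)
open import Function using (_∘_)
open import Function.Properties.Inverse using (↔⇒↣)
open import Relation.Nullary using (yes; no; ¬?)
open import Relation.Nullary.Decidable using (via-injection; decidable-stable)
open import Relation.Binary.Definitions using (DecidableEquality)
open import Relation.Binary.PropositionalEquality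
  using (_≡_; _≢_; refl; sym; trans; cong; cong₂; subst; module ≡-Reasoning)
open import Algebra.Bundles using (CommutativeRing)
import Algebra.Solver.Ring.NaturalCoefficients.Default as SemiringSolver
import Algebra.Properties.Ring as RingProperties
import Algebra.Properties.Group as GroupProperties

Unique⇒lookup-injective : ∀ {a} {A : Set a} {xs : List A} → Unique xs →
                          ∀ i j → List.lookup xs i ≡ List.lookup xs j → i ≡ j
Unique⇒lookup-injective (_  ∷ _) Fin.zero    Fin.zero    _  = refl
Unique⇒lookup-injective (x∉ ∷ _) Fin.zero    (Fin.suc j) eq = ⊥-elim (All.lookup x∉ (∈-lookup j) eq)
Unique⇒lookup-injective (x∉ ∷ _) (Fin.suc i) Fin.zero    eq = ⊥-elim (All.lookup x∉ (∈-lookup i) (sym eq))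
Unique⇒lookup-injective (_  ∷ u) (Fin.suc i) (Fin.suc j) eq = cong Fin.suc (Unique⇒lookup-injective u i j eq)

dim : ℕ → ℕ → ℕ
dim n       zero    = 1
dim zero    (suc s) = 1
dim (suc n) (suc s) = dim (suc n) s ℕ.+ dim n (suc s)

dim≡C : ∀ n s → dim n s ≡ (n ℕ.+ s) C s
dim≡C zero    zero    = refl
dim≡C (suc n) zero    = refl
dim≡C zero    (suc s) = sym (nCn≡1 (suc s))
dim≡C (suc n) (suc s) = begin
  dim (suc n) s ℕ.+ dim n (suc s)                 ≡⟨ cong₂ ℕ._+_ (dim≡C (suc n) s) (dim≡C n (suc s)) ⟩
  suc (n ℕ.+ s) C s ℕ.+ (n ℕ.+ suc s) C suc s      ≡⟨ cong (λ k → suc (n ℕ.+ s) C s ℕ.+ k C suc s) (ℕₚ.+-suc n s) ⟩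
  suc (n ℕ.+ s) C s ℕ.+ suc (n ℕ.+ s) C suc s      ≡⟨ nCk+nC[k+1]≡[n+1]C[k+1] (suc (n ℕ.+ s)) s ⟩
  suc (suc (n ℕ.+ s)) C suc s                     ≡⟨ cong (λ k → suc k C suc s) (sym (ℕₚ.+-suc n s)) ⟩
  (suc n ℕ.+ suc s) C suc s                       ∎
  where open ≡-Reasoning

module FieldAlgebra {c} (F : FiniteField c) where
  open FiniteField F

  commutativeRing : CommutativeRing c c
  commutativeRing = record { isCommutativeRing = isCommutativeRing }

  open CommutativeRing commutativeRing
    using (_-_; zeroˡ; zeroʳ; +-identityˡ; *-identityʳ; +-assoc; -‿inverseʳ; +-group; ring; commutativeSemiring)
  open GroupProperties +-group using (x∙y⁻¹≈ε⇒x≈y)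
  open RingProperties ring using (-‿distribˡ-*)
  open SemiringSolver commutativeSemiring using (solve; _:=_; _:+_; _:*_; con)

  _≟_ : DecidableEquality Carrier
  _≟_ = via-injection (↔⇒↣ enum) Finₚ._≟_

  x*y≢0 : ∀ {x y} → x ≢ 0# → y ≢ 0# → x * y ≢ 0#
  x*y≢0 {x} {y} x≢0 y≢0 xy≡0 = y≢0 (begin
    y               ≡⟨ sym (*-identityʳ y) ⟩
    y * 1#          ≡⟨ cong (y *_) (sym (⁻¹-inverse x x≢0)) ⟩
    y * (x * x ⁻¹)  ≡⟨ solve 3 (λ x y x⁻¹ → y :* (x :* x⁻¹) := (x :* y) :* x⁻¹) refl x y (x ⁻¹) ⟩
    (x * y) * x ⁻¹  ≡⟨ cong (_* x ⁻¹) xy≡0 ⟩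
    0# * x ⁻¹       ≡⟨ zeroˡ (x ⁻¹) ⟩
    0#              ∎)
    where open ≡-Reasoning

  x-y≢0 : ∀ {x y} → x ≢ y → x - y ≢ 0#
  x-y≢0 {x} {y} x≢y = x≢y ∘ x∙y⁻¹≈ε⇒x≈y x y

  x*0+y≡y : ∀ x y → x * 0# + y ≡ y
  x*0+y≡y x y = trans (cong (_+ y) (zeroʳ x)) (+-identityˡ y)

  infix 8 _∙_
  _∙_ : ∀ {n} → Vec Carrier n → Vec Carrier n → Carrier
  _∙_ = dot F

  ∙-++ : ∀ {m n} (u v : Vec Carrier m) (u′ v′ : Vec Carrier n) →
         (u ++ u′) ∙ (v ++ v′) ≡ u ∙ v + u′ ∙ v′
  ∙-++ []      []      u′ v′ = sym (+-identityˡ (u′ ∙ v′))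
  ∙-++ (x ∷ u) (y ∷ v) u′ v′ =
    trans (cong (x * y +_) (∙-++ u v u′ v′)) (sym (+-assoc (x * y) (u ∙ v) (u′ ∙ v′)))

  ∙-scaleʳ : ∀ {n} t (u v : Vec Carrier n) → u ∙ Vec.map (t *_) v ≡ t * (u ∙ v)
  ∙-scaleʳ t []      []      = sym (zeroʳ t)
  ∙-scaleʳ t (x ∷ u) (y ∷ v) = trans (cong (x * (t * y) +_) (∙-scaleʳ t u v))
    (solve 4 (λ t x y d → x :* (t :* y) :+ t :* d := t :* (x :* y :+ d)) refl t x y (u ∙ v))

  ∙-tail : ∀ {n} (u v : Vec Carrier (suc n)) → head u ≡ 0# → tail u ∙ tail v ≡ u ∙ v
  ∙-tail (_ ∷ u) (y ∷ v) refl = sym (trans (cong (_+ u ∙ v) (zeroˡ y)) (+-identityˡ (u ∙ v)))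

  addScaled : ∀ {n} → Vec Carrier n → Carrier → Vec Carrier n → Vec Carrier n
  addScaled u t w = Vec.zipWith (λ a b → a + t * b) u w

  ∙-addScaled : ∀ {n} (u : Vec Carrier n) t w v → addScaled u t w ∙ v ≡ u ∙ v + t * (w ∙ v)
  ∙-addScaled []      t []      []      = solve 1 (λ t → con 0 := con 0 :+ t :* con 0) refl t
  ∙-addScaled (a ∷ u) t (b ∷ w) (y ∷ v) = trans (cong ((a + t * b) * y +_) (∙-addScaled u t w v))
    (solve 6 (λ a b y t d e → (a :+ t :* b) :* y :+ (d :+ t :* e) := a :* y :+ d :+ t :* (b :* y :+ e))
           refl a b y t (u ∙ v) (w ∙ v))

  head-addScaled : ∀ {n} (u : Vec Carrier (suc n)) t w → head (addScaled u t w) ≡ head u + t * head w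
  head-addScaled (_ ∷ _) t (_ ∷ _) = refl

  eliminate : ∀ {n} → Vec Carrier (suc n) → Vec Carrier (suc n) → Vec Carrier (suc n)
  eliminate p w = addScaled w (- (head w * head p ⁻¹)) p

  head-eliminate : ∀ {n} (p w : Vec Carrier (suc n)) → head p ≢ 0# → head (eliminate p w) ≡ 0#
  head-eliminate p w p₀≢0 = begin
    head (eliminate p w)       ≡⟨ head-addScaled w _ p ⟩
    w₀ + - (w₀ * p₀ ⁻¹) * p₀   ≡⟨ cong (w₀ +_) (sym (-‿distribˡ-* (w₀ * p₀ ⁻¹) p₀)) ⟩
    w₀ - w₀ * p₀ ⁻¹ * p₀       ≡⟨ cong (λ e → w₀ - e) (solve 3 (λ w₀ p₀ p₀⁻¹ → w₀ :* p₀⁻¹ :* p₀ := w₀ :* (p₀ :* p₀⁻¹)) refl w₀ p₀ (p₀ ⁻¹)) ⟩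
    w₀ - w₀ * (p₀ * p₀ ⁻¹)     ≡⟨ cong (λ e → w₀ - w₀ * e) (⁻¹-inverse p₀ p₀≢0) ⟩
    w₀ - w₀ * 1#               ≡⟨ cong (λ e → w₀ - e) (*-identityʳ w₀) ⟩
    w₀ - w₀                    ≡⟨ -‿inverseʳ w₀ ⟩
    0#                         ∎
    where open ≡-Reasoning
          w₀ = head w
          p₀ = head p

  ∙-eliminate : ∀ {n} (p w v : Vec Carrier (suc n)) → p ∙ v ≡ 0# → eliminate p w ∙ v ≡ w ∙ v
  ∙-eliminate p w v p∙v≡0 = trans (∙-addScaled w _ p v)
    (trans (cong (λ e → w ∙ v + - (head w * head p ⁻¹) * e) p∙v≡0)
           (solve 2 (λ d t → d :+ t :* con 0 := d) refl (w ∙ v) (- (head w * head p ⁻¹))))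

  record Biorthogonal {m n} (u v : Fin m → Vec Carrier n) : Set c where
    constructor biorthogonal
    field
      off-diagonal : ∀ i j → i ≢ j → u i ∙ v j ≡ 0#
      diagonal     : ∀ i → u i ∙ v i ≢ 0#

  Biorthogonal-tail : ∀ {m n} (u v : Fin m → Vec Carrier (suc n)) → (∀ i → head (u i) ≡ 0#) →
                      Biorthogonal u v → Biorthogonal (tail ∘ u) (tail ∘ v)
  Biorthogonal-tail u v heads≡0 (biorthogonal off diag) = biorthogonal
    (λ i j i≢j → trans (tail∙tail i j) (off i j i≢j))
    (λ i → diag i ∘ trans (sym (tail∙tail i i)))
    where
      tail∙tail : ∀ i j → tail (u i) ∙ tail (v j) ≡ u i ∙ v j
      tail∙tail i j = ∙-tail (u i) (v j) (heads≡0 i)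

  Biorthogonal-eliminate : ∀ {m n} (u v : Fin (suc m) → Vec Carrier (suc n)) k → head (u k) ≢ 0# →
    Biorthogonal u v →
    Biorthogonal (λ i → tail (eliminate (u k) (u (punchIn k i)))) (λ j → tail (v (punchIn k j)))
  Biorthogonal-eliminate u v k pivot≢0 (biorthogonal off diag) = biorthogonal
    (λ i j i≢j → trans (reduced i j) (off _ _ (i≢j ∘ Finₚ.punchIn-injective k i j)))
    (λ i → diag (punchIn k i) ∘ trans (sym (reduced i i)))
    where
      reduced : ∀ i j → tail (eliminate (u k) (u (punchIn k i))) ∙ tail (v (punchIn k j))
                        ≡ u (punchIn k i) ∙ v (punchIn k j)
      reduced i j = trans (∙-tail (eliminate (u k) uᵢ) vⱼ (head-eliminate (u k) uᵢ pivot≢0))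
                          (∙-eliminate (u k) uᵢ vⱼ (off k (punchIn k j) (Finₚ.punchInᵢ≢i k j ∘ sym)))
        where uᵢ = u (punchIn k i)
              vⱼ = v (punchIn k j)

  Biorthogonal⇒≤ : ∀ {m n} (u v : Fin m → Vec Carrier n) → Biorthogonal u v → m ≤ n
  Biorthogonal⇒≤ {zero}          u v _           = z≤n
  Biorthogonal⇒≤ {suc m} {zero}  u v b           =
    ⊥-elim (Biorthogonal.diagonal b Fin.zero (empty∙ (u Fin.zero) (v Fin.zero)))
    where empty∙ : (x y : Vec Carrier 0) → x ∙ y ≡ 0#
          empty∙ [] [] = refl
  Biorthogonal⇒≤ {suc m} {suc n} u v b with Finₚ.any? (λ k → ¬? (head (u k) ≟ 0#))
  ... | yes (k , pivot≢0) = s≤s (Biorthogonal⇒≤ _ _ (Biorthogonal-eliminate u v k pivot≢0 b))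
  ... | no noPivot = ℕₚ.m≤n⇒m≤1+n (Biorthogonal⇒≤ _ _ (Biorthogonal-tail u v heads≡0 b))
    where
      heads≡0 : ∀ k → head (u k) ≡ 0#
      heads≡0 k = decidable-stable (head (u k) ≟ 0#) (λ h≢0 → noPivot (k , h≢0))

  -- Poly n s: polynomials of degree ≤ s in x₀ … xₙ₋₁.  For n, s > 0 such a polynomial
  -- is uniquely p x₀+ q = x₀ · p + q with p of degree ≤ s - 1 and q free of x₀;
  -- otherwise it is a constant.  This is the recursion defining dim.
  infixr 5 _x₀+_
  data Poly : ℕ → ℕ → Set c where
    κ     : ∀ {n} → Carrier → Poly n zero
    κ′    : ∀ {s} → Carrier → Poly zero (suc s)
    _x₀+_ : ∀ {n s} → Poly (suc n) s → Poly n (suc s) → Poly (suc n) (suc s)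

  eval : ∀ {n s} → Poly n s → Vec Carrier n → Carrier
  eval (κ a)      _        = a
  eval (κ′ a)     _        = a
  eval (p x₀+ q)  (x ∷ xs) = x * eval p (x ∷ xs) + eval q xs

  constant : ∀ {n s} → Carrier → Poly n s
  constant {n}     {zero}  a = κ a
  constant {zero}  {suc s} a = κ′ a
  constant {suc n} {suc s} a = constant 0# x₀+ constant a

  infixl 6 _+ₚ_
  _+ₚ_ : ∀ {n s} → Poly n s → Poly n s → Poly n s
  κ a      +ₚ κ b        = κ (a + b)
  κ′ a     +ₚ κ′ b       = κ′ (a + b)
  (p x₀+ q) +ₚ (p′ x₀+ q′) = (p +ₚ p′) x₀+ (q +ₚ q′)

  infixr 7 _·ₚ_
  _·ₚ_ : ∀ {n s} → Carrier → Poly n s → Poly n s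
  t ·ₚ κ a      = κ (t * a)
  t ·ₚ κ′ a     = κ′ (t * a)
  t ·ₚ (p x₀+ q) = (t ·ₚ p) x₀+ (t ·ₚ q)

  embed : ∀ {n s} → Poly n s → Poly (suc n) s
  embed {s = zero}  (κ a) = κ a
  embed {s = suc s} p     = constant 0# x₀+ p

  mulAffine : ∀ {n s} → Vec Carrier n → Carrier → Poly n s → Poly n (suc s)
  mulAffine []       r (κ a)     = κ′ (- r * a)
  mulAffine []       r (κ′ a)    = κ′ (- r * a)
  mulAffine (b ∷ bs) r (κ a)     = κ (b * a) x₀+ mulAffine bs r (κ a)
  mulAffine (b ∷ bs) r (p x₀+ q) = (mulAffine (b ∷ bs) r p +ₚ b ·ₚ embed q) x₀+ mulAffine bs r q

  eval-constant : ∀ {n s} a (x : Vec Carrier n) → eval (constant {n} {s} a) x ≡ a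
  eval-constant {n}     {zero}  a _        = refl
  eval-constant {zero}  {suc s} a _        = refl
  eval-constant {suc n} {suc s} a (x ∷ xs) =
    trans (cong₂ (λ e f → x * e + f) (eval-constant {s = s} 0# (x ∷ xs)) (eval-constant {s = suc s} a xs)) (x*0+y≡y x a)

  eval-+ₚ : ∀ {n s} (p q : Poly n s) x → eval (p +ₚ q) x ≡ eval p x + eval q x
  eval-+ₚ (κ a)     (κ b)       _        = refl
  eval-+ₚ (κ′ a)    (κ′ b)      _        = refl
  eval-+ₚ (p x₀+ q) (p′ x₀+ q′) (x ∷ xs) =
    trans (cong₂ (λ e f → x * e + f) (eval-+ₚ p p′ (x ∷ xs)) (eval-+ₚ q q′ xs))
      (solve 5 (λ x a a′ b b′ → x :* (a :+ a′) :+ (b :+ b′) := (x :* a :+ b) :+ (x :* a′ :+ b′))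
             refl x (eval p (x ∷ xs)) (eval p′ (x ∷ xs)) (eval q xs) (eval q′ xs))

  eval-·ₚ : ∀ {n s} t (p : Poly n s) x → eval (t ·ₚ p) x ≡ t * eval p x
  eval-·ₚ t (κ a)     _        = refl
  eval-·ₚ t (κ′ a)    _        = refl
  eval-·ₚ t (p x₀+ q) (x ∷ xs) =
    trans (cong₂ (λ e f → x * e + f) (eval-·ₚ t p (x ∷ xs)) (eval-·ₚ t q xs))
      (solve 4 (λ x t a b → x :* (t :* a) :+ t :* b := t :* (x :* a :+ b))
             refl x t (eval p (x ∷ xs)) (eval q xs))

  eval-embed : ∀ {n s} (p : Poly n s) x xs → eval (embed p) (x ∷ xs) ≡ eval p xs
  eval-embed {s = zero}  (κ a) x xs = refl
  eval-embed {s = suc s} p     x xs =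
    trans (cong (λ e → x * e + eval p xs) (eval-constant {s = s} 0# (x ∷ xs))) (x*0+y≡y x (eval p xs))

  eval-mulAffine : ∀ {n s} b r (p : Poly n s) x → eval (mulAffine b r p) x ≡ (x ∙ b - r) * eval p x
  eval-mulAffine []       r (κ a)  [] = solve 2 (λ -r a → -r :* a := (con 0 :+ -r) :* a) refl (- r) a
  eval-mulAffine []       r (κ′ a) [] = solve 2 (λ -r a → -r :* a := (con 0 :+ -r) :* a) refl (- r) a
  eval-mulAffine (b ∷ bs) r (κ a) (x ∷ xs) =
    trans (cong (x * (b * a) +_) (eval-mulAffine bs r (κ a) xs))
      (solve 5 (λ x b a L -r → x :* (b :* a) :+ (L :+ -r) :* a := (x :* b :+ L :+ -r) :* a)
             refl x b a (xs ∙ bs) (- r))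
  eval-mulAffine (b ∷ bs) r (p x₀+ q) (x ∷ xs) = begin
    x * eval (mulAffine (b ∷ bs) r p +ₚ b ·ₚ embed q) (x ∷ xs) + eval (mulAffine bs r q) xs
      ≡⟨ cong₂ (λ e f → x * e + f) first (eval-mulAffine bs r q xs) ⟩
    x * ((x * b + L - r) * P + b * Q) + (L - r) * Q
      ≡⟨ solve 6 (λ x b L -r P Q → x :* ((x :* b :+ L :+ -r) :* P :+ b :* Q) :+ (L :+ -r) :* Q
                                   := (x :* b :+ L :+ -r) :* (x :* P :+ Q)) refl x b L (- r) P Q ⟩
    (x * b + L - r) * (x * P + Q)
      ∎
    where
      open ≡-Reasoning
      L = xs ∙ bs
      P = eval p (x ∷ xs)
      Q = eval q xs
      first : eval (mulAffine (b ∷ bs) r p +ₚ b ·ₚ embed q) (x ∷ xs) ≡ (x * b + L - r) * P + b * Q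
      first = trans (eval-+ₚ (mulAffine (b ∷ bs) r p) (b ·ₚ embed q) (x ∷ xs))
        (cong₂ _+_ (eval-mulAffine (b ∷ bs) r p (x ∷ xs))
                   (trans (eval-·ₚ b (embed q) (x ∷ xs)) (cong (b *_) (eval-embed q x xs))))

  coefficients : ∀ {n s} → Poly n s → Vec Carrier (dim n s)
  coefficients (κ a)     = a ∷ []
  coefficients (κ′ a)    = a ∷ []
  coefficients (p x₀+ q) = coefficients p ++ coefficients q

  monomials : ∀ {n} s → Vec Carrier n → Vec Carrier (dim n s)
  monomials         zero    _        = 1# ∷ []
  monomials {zero}  (suc s) _        = 1# ∷ []
  monomials {suc n} (suc s) (x ∷ xs) = Vec.map (x *_) (monomials s (x ∷ xs)) ++ monomials (suc s) xs

  eval≡coefficients∙monomials : ∀ {n s} (p : Poly n s) x → eval p x ≡ coefficients p ∙ monomials s x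
  eval≡coefficients∙monomials (κ a)  _ = solve 1 (λ a → a := a :* con 1 :+ con 0) refl a
  eval≡coefficients∙monomials (κ′ a) _ = solve 1 (λ a → a := a :* con 1 :+ con 0) refl a
  eval≡coefficients∙monomials {s = suc s} (p x₀+ q) (x ∷ xs) = begin
    x * eval p (x ∷ xs) + eval q xs
      ≡⟨ cong₂ (λ e f → x * e + f) (eval≡coefficients∙monomials p (x ∷ xs)) (eval≡coefficients∙monomials q xs) ⟩
    x * (coefficients p ∙ monomials s (x ∷ xs)) + coefficients q ∙ monomials (suc s) xs
      ≡⟨ cong (_+ coefficients q ∙ monomials (suc s) xs) (sym (∙-scaleʳ x (coefficients p) _)) ⟩
    coefficients p ∙ Vec.map (x *_) (monomials s (x ∷ xs)) + coefficients q ∙ monomials (suc s) xs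
      ≡⟨ sym (∙-++ (coefficients p) _ (coefficients q) _) ⟩
    (coefficients p ++ coefficients q) ∙ monomials (suc s) (x ∷ xs)
      ∎
    where open ≡-Reasoning

  ∏-minus : Carrier → List Carrier → Carrier
  ∏-minus t = List.foldr (λ r p → (t - r) * p) 1#

  ∏-minus-∈ : ∀ {t R} → t ∈ R → ∏-minus t R ≡ 0#
  ∏-minus-∈ {t} {_ List.∷ R} (here refl) = trans (cong (_* ∏-minus t R) (-‿inverseʳ t)) (zeroˡ _)
  ∏-minus-∈ {t} {r List.∷ _} (there t∈R) = trans (cong ((t - r) *_) (∏-minus-∈ t∈R)) (zeroʳ _)

  ∏-minus-∉ : ∀ {t} R → (∀ r → r ∈ R → r ≢ t) → ∏-minus t R ≢ 0#
  ∏-minus-∉ List.[]       _   = 0≢1 ∘ sym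
  ∏-minus-∉ (r List.∷ R)  R∌t =
    x*y≢0 (x-y≢0 (R∌t r (here refl) ∘ sym)) (∏-minus-∉ R (λ r′ r′∈R → R∌t r′ (there r′∈R)))

  vanishing : ∀ {n} → Vec Carrier n → (R : List Carrier) → Poly n (length R)
  vanishing b List.[]       = constant 1#
  vanishing b (r List.∷ R)  = mulAffine b r (vanishing b R)

  eval-vanishing : ∀ {n} (b : Vec Carrier n) R x → eval (vanishing b R) x ≡ ∏-minus (x ∙ b) R
  eval-vanishing b List.[]      x = eval-constant {s = 0} 1# x
  eval-vanishing b (r List.∷ R) x =
    trans (eval-mulAffine b r (vanishing b R) x) (cong ((x ∙ b - r) *_) (eval-vanishing b R x))

  coefficients-vanishing∙monomials : ∀ {n} (b : Vec Carrier n) R x →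
    coefficients (vanishing b R) ∙ monomials (length R) x ≡ ∏-minus (x ∙ b) R
  coefficients-vanishing∙monomials b R x =
    trans (sym (eval≡coefficients∙monomials (vanishing b R) x)) (eval-vanishing b R x)

-- ℕ's _+_ and _*_ are opened only here: inside FieldAlgebra these names are the field operations.
open import Data.Nat using (ℕ; _≤_; _+_; _*_)

lemma2p2 : ∀ {c} (F : FiniteField c) (n : ℕ) → 1 ≤ n →
  (α : FiniteField.Carrier F) →
  (R : List (FiniteField.Carrier F)) → Unique R → (∀ r → r ∈ R → r ≢ α) →
  (A : List (Vec (FiniteField.Carrier F) n)) → Unique A →
  (∀ a → a ∈ A → dot F a a ≡ α) →
  (∀ x y → x ∈ A → y ∈ A → x ≢ y → dot F x y ∈ R) →
  length A ≤ 2 * ((n + length R) C length R)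
lemma2p2 F n _ α R _ R∌α A uniqueA norm inner = begin
  length A                    ≤⟨ Biorthogonal⇒≤ u v (biorthogonal off diag) ⟩
  dim n s                     ≡⟨ dim≡C n s ⟩
  (n + s) C s                 ≤⟨ ℕₚ.m≤m+n _ _ ⟩
  2 * ((n + s) C s)           ∎
  where
    open ℕₚ.≤-Reasoning
    open FiniteField F using (0#)
    open FieldAlgebra F
    s = length R
    a = List.lookup A
    u v : Fin (length A) → Vec (FiniteField.Carrier F) (dim n s)
    u i = coefficients (vanishing (a i) R)
    v j = monomials s (a j)
    off : ∀ i j → i ≢ j → u i ∙ v j ≡ 0#
    off i j i≢j = trans (coefficients-vanishing∙monomials (a i) R (a j))
      (∏-minus-∈ (inner (a j) (a i) (∈-lookup j) (∈-lookup i) (i≢j ∘ sym ∘ Unique⇒lookup-injective uniqueA j i)))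
    diag : ∀ i → u i ∙ v i ≢ 0#
    diag i = subst (λ t → ∏-minus t R ≢ 0#) (sym (norm (a i) (∈-lookup i))) (∏-minus-∉ R R∌α)
           ∘ trans (sym (coefficients-vanishing∙monomials (a i) R (a i)))
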